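{- Let $L$ be a finite semilattice and let $B\subseteq L^n$ be a $(\wedge,\vee)$-closed set. Then the number of $\vee$-irreducible elements of $B$ is at most $n\,|L^{\mathrm{ir}}|$, where $L^{\mathrm{ir}}$ is the set of $\vee$-irreducible elements of $L$.
   Context: Semilattices are meet-semilattices; the join $x\vee y$ (least common upper bound) may not exist. An element $l$ is $\vee$-irreducible if it is not the minimum and $l=a\vee b$ implies $l=a$ or $l=b$. $L^n$ carries the componentwise (product) order, so meets and, when they exist, joins are computed componentwise. A subset $B\subseteq L^n$ is $(\wedge,\vee)$-closed if both of the following hold: - $b_1\wedge b_2\in B$ for all $b_1,b_2\in B$; - $b_1\vee b_2\in B$ whenever $b_1,b_2\in B$ and $b_1\vee b_2$ exists in $L^n$. $B$ is regarded as a semilattice with the induced order. -}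

module Defs where

open import Level using (Level; _⊔_; suc)
open import Data.Nat using (ℕ)
open import Data.Fin using (Fin)
open import Data.List using (List)
open import Data.List.Relation.Unary.Any using (Any)
open import Data.List.Relation.Unary.All using (All)
open import Data.List.Relation.Unary.AllPairs using (AllPairs)
open import Data.Product using (_×_; ∃)
open import Data.Sum using (_⊎_)
open import Relation.Nullary using (¬_)
open import Relation.Unary using (Pred; _∈_)
open import Relation.Binary.Lattice using (MeetSemilattice)

module _ {a ℓ : Level} {A : Set a} (_≈_ : A → A → Set ℓ) where

  Distinct : List A → Set (a ⊔ ℓ)
  Distinct = AllPairs (λ x y → ¬ (x ≈ y))

  Covers : List A → Set (a ⊔ ℓ)
  Covers xs = ∀ x → Any (x ≈_) xs

  -- xs lists exactly the elements satisfying P, each once (up to ≈);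
  -- so  length xs  is the cardinality of {x | P x}.
  Enumerates : ∀ {p} → Pred A p → List A → Set (a ⊔ ℓ ⊔ p)
  Enumerates P xs = Distinct xs × All P xs × (∀ x → P x → Any (x ≈_) xs)

module _ {c ℓ₁ ℓ₂ : Level} (L : MeetSemilattice c ℓ₁ ℓ₂) where
  open MeetSemilattice L

  FiniteSL : Set (c ⊔ ℓ₁)
  FiniteSL = ∃ λ (xs : List Carrier) → Covers _≈_ xs

  IsJoinL : Carrier → Carrier → Carrier → Set (c ⊔ ℓ₂)
  IsJoinL x y z = x ≤ z × y ≤ z × (∀ w → x ≤ w → y ≤ w → z ≤ w)

  JoinIrreducible : Pred Carrier (c ⊔ ℓ₁ ⊔ ℓ₂)
  JoinIrreducible l =
    ¬ (∀ x → l ≤ x) × (∀ a b → IsJoinL a b l → l ≈ a ⊎ l ≈ b)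

  module Power (n : ℕ) where

    Vecⁿ : Set c
    Vecⁿ = Fin n → Carrier

    _≈ⁿ_ : Vecⁿ → Vecⁿ → Set ℓ₁
    x ≈ⁿ y = ∀ i → x i ≈ y i

    _≤ⁿ_ : Vecⁿ → Vecⁿ → Set ℓ₂
    x ≤ⁿ y = ∀ i → x i ≤ y i

    _∧ⁿ_ : Vecⁿ → Vecⁿ → Vecⁿ
    (x ∧ⁿ y) i = x i ∧ y i

    IsJoinⁿ : Vecⁿ → Vecⁿ → Vecⁿ → Set (c ⊔ ℓ₂)
    IsJoinⁿ x y z = x ≤ⁿ z × y ≤ⁿ z × (∀ w → x ≤ⁿ w → y ≤ⁿ w → z ≤ⁿ w)

    RespectsEq : ∀ {p} → Pred Vecⁿ p → Set (c ⊔ ℓ₁ ⊔ p)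
    RespectsEq B = ∀ {x y} → x ≈ⁿ y → x ∈ B → y ∈ B

    MeetJoinClosed : ∀ {p} → Pred Vecⁿ p → Set (c ⊔ ℓ₂ ⊔ p)
    MeetJoinClosed B =
      (∀ b₁ b₂ → b₁ ∈ B → b₂ ∈ B → (b₁ ∧ⁿ b₂) ∈ B) ×
      (∀ b₁ b₂ z → b₁ ∈ B → b₂ ∈ B → IsJoinⁿ b₁ b₂ z → z ∈ B)

    IsJoinIn : ∀ {p} → Pred Vecⁿ p → Vecⁿ → Vecⁿ → Vecⁿ → Set (c ⊔ ℓ₂ ⊔ p)
    IsJoinIn B x y z =
      z ∈ B × x ≤ⁿ z × y ≤ⁿ z × (∀ w → w ∈ B → x ≤ⁿ w → y ≤ⁿ w → z ≤ⁿ w)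

    JoinIrreducibleIn : ∀ {p} → Pred Vecⁿ p → Pred Vecⁿ (c ⊔ ℓ₁ ⊔ ℓ₂ ⊔ p)
    JoinIrreducibleIn B l =
      l ∈ B ×
      ¬ (∀ x → x ∈ B → l ≤ⁿ x) ×
      (∀ a b → a ∈ B → b ∈ B → IsJoinIn B a b l → l ≈ⁿ a ⊎ l ≈ⁿ b)

-- For i : Fin n and l ∈ L call b ∈ B *generated at (i , l)* if b is the
-- least w ∈ B with l ≤ w i.  Such a b is unique, so it suffices to show that
-- every join-irreducible b of B is generated at some (i , l) with l
-- join-irreducible in L.  For each (i , l) let gᵢₗ be the least w ∈ B with
-- l ≤ w i (if l ≤ b i; otherwise the least element of B).  Every gᵢₗ lies
-- below b, and b lies below every upper bound of the gᵢₗ in B, because in a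
-- finite semilattice each coordinate b i is determined by the join-irreducibles
-- below it.  So b is the join in B of the gᵢₗ, and being join-irreducible it
-- equals one of them, which gives the generating pair.
--
-- Orders of (semi)lattices are
-- written ⊑, keeping ≤ for ℕ.
module Submission where

open import Defs
open import Level using (_⊔_)
open import Data.Nat using (ℕ; _≤_; _*_)
open import Data.List using (List; length)
open import Data.List.Relation.Unary.All using (All)
open import Relation.Unary using (Pred)
open import Relation.Binary.Lattice using (MeetSemilattice)

import Data.Nat as ℕ
open import Data.Fin using (Fin; zero; suc; combine)
open import Data.Fin.Properties using (injective⇒≤; combine-injective; all?)
import Data.Vec.Functional as Vector
open import Data.List using ([]; _∷_; [_]; lookup; map; allFin; cartesianProduct; cartesianProductWith)
open import Data.List.Relation.Unary.All using ([]; _∷_; lookupAny; universal)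
import Data.List.Relation.Unary.All as All
import Data.List.Relation.Unary.All.Properties as Allₚ
open import Data.List.Relation.Unary.Any using (Any; here; there; index; satisfied)
import Data.List.Relation.Unary.Any.Properties as Anyₚ
open import Data.List.Relation.Unary.AllPairs using (_∷_)
open import Data.List.Membership.Propositional.Properties using (∈-lookup; ∈-allFin; ∈-cartesianProduct⁺)
open import Data.Product using (Σ-syntax; _×_; _,_; proj₁; proj₂)
open import Data.Sum using (_⊎_; inj₁; inj₂; [_,_]′)
open import Data.Empty using (⊥-elim)
open import Relation.Nullary using (¬_; yes; no)
open import Relation.Nullary.Decidable using (map′; decidable-stable; ¬¬-excluded-middle; _×-dec_; _→-dec_; ¬?)
open import Relation.Unary using (Decidable)
open import Relation.Binary.Core using (Rel)
open import Relation.Binary.Definitions using (Symmetric; _Respects_) renaming (Decidable to Decidable₂)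
open import Relation.Binary.Bundles using (Poset)
open import Relation.Binary.PropositionalEquality using (_≡_; refl; cong)

¬¬-All : ∀ {a f} {A : Set a} {F : A → Set f} → (∀ x → ¬ ¬ F x) → ∀ ys → ¬ ¬ All F ys
¬¬-All h []       k = k []
¬¬-All h (y ∷ ys) k = h y λ fy → ¬¬-All h ys λ fys → k (fy ∷ fys)

module _ {a ℓ} {A : Set a} {_≈_ : Rel A ℓ} {xs : List A} (cover : Covers _≈_ xs) where

  ¬¬-∀-covered : ∀ {f} {F : A → Set f} → (∀ {x y} → x ≈ y → F y → F x) →
                 (∀ x → ¬ ¬ F x) → ¬ ¬ (∀ x → F x)
  ¬¬-∀-covered transport h k = ¬¬-All h xs λ all → k λ x →
    let (fy , x≈y) = lookupAny all (cover x) in transport x≈y fy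

  ¬¬-decidable : ∀ {p} {P : Pred A p} → Symmetric _≈_ → P Respects _≈_ → ¬ ¬ Decidable P
  ¬¬-decidable sym resp =
    ¬¬-∀-covered (λ x≈y → map′ (resp (sym x≈y)) (resp x≈y)) (λ _ → ¬¬-excluded-middle)

¬¬-decidable-order : ∀ {c ℓ₁ ℓ₂} (P : Poset c ℓ₁ ℓ₂) {xs : List (Poset.Carrier P)} →
                     Covers (Poset._≈_ P) xs → ¬ ¬ Decidable₂ (Poset._≤_ P)
¬¬-decidable-order P cover =
  ¬¬-∀-covered cover
    (λ x≈y dec z → map′ (≤-respˡ-≈ (Eq.sym x≈y)) (≤-respˡ-≈ x≈y) (dec z))
    (λ _ → ¬¬-decidable cover Eq.sym ≤-respʳ-≈)
  where open Poset P using (≤-respˡ-≈; ≤-respʳ-≈; module Eq)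

module _ {a ℓ} {A : Set a} {_≈_ : Rel A ℓ} (sym : Symmetric _≈_) where

  distinct-lookup : ∀ {xs} → Distinct _≈_ xs → ∀ i j → lookup xs i ≈ lookup xs j → i ≡ j
  distinct-lookup (_ ∷ _)     zero    zero    _ = refl
  distinct-lookup (x≉ ∷ _)    zero    (suc j) e = ⊥-elim (All.lookup x≉ (∈-lookup j) e)
  distinct-lookup (x≉ ∷ _)    (suc i) zero    e = ⊥-elim (All.lookup x≉ (∈-lookup i) (sym e))
  distinct-lookup (_ ∷ dist)  (suc i) (suc j) e = cong suc (distinct-lookup dist i j e)

  distinct-length-≤ : ∀ {p k} {P : Pred A p} (code : ∀ {x} → P x → Fin k) →
                      (∀ {x y} (px : P x) (py : P y) → code px ≡ code py → x ≈ y) →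
                      ∀ {xs} → Distinct _≈_ xs → All P xs → length xs ≤ k
  distinct-length-≤ code code-injective dist ps =
    injective⇒≤ λ {i} {j} e → distinct-lookup dist i j
      (code-injective (All.lookup ps (∈-lookup i)) (All.lookup ps (∈-lookup j)) e)

module _ {a ℓ} {A : Set a} {_≈_ : Rel A ℓ} {xs : List A} (cover : Covers _≈_ xs) where

  vectors : ∀ n → List (Fin n → A)
  vectors ℕ.zero    = [ Vector.[] ]
  vectors (ℕ.suc n) = cartesianProductWith Vector._∷_ xs (vectors n)

  vectors-cover : ∀ n → Covers (λ u v → ∀ i → u i ≈ v i) (vectors n)
  vectors-cover ℕ.zero    v = here λ ()
  vectors-cover (ℕ.suc n) v =
    Anyₚ.cartesianProductWith⁺ Vector._∷_ (λ { x≈ u≈ zero → x≈ ; x≈ u≈ (suc i) → u≈ i })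
      (cover (v zero)) (vectors-cover n (Vector.tail v))

power : ∀ {c ℓ₁ ℓ₂} → MeetSemilattice c ℓ₁ ℓ₂ → ℕ → MeetSemilattice c ℓ₁ ℓ₂
power L n = record
  { _≈_ = _≈ⁿ_ ; _≤_ = _≤ⁿ_ ; _∧_ = _∧ⁿ_
  ; isMeetSemilattice = record
    { isPartialOrder = record
      { isPreorder = record
        { isEquivalence = record
          { refl = λ i → Eq.refl
          ; sym = λ e i → Eq.sym (e i)
          ; trans = λ e f i → Eq.trans (e i) (f i) }
        ; reflexive = λ e i → reflexive (e i)
        ; trans = λ p q i → trans (p i) (q i) }
      ; antisym = λ p q i → antisym (p i) (q i) }
    ; infimum = λ x y → (λ i → x∧y≤x (x i) (y i)) , (λ i → x∧y≤y (x i) (y i)) ,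
                        λ z p q i → ∧-greatest (p i) (q i) } }
  where open MeetSemilattice L
        open Power L n

module Minimal {c ℓ₁ ℓ₂} (P : Poset c ℓ₁ ℓ₂) (_≤?_ : Decidable₂ (Poset._≤_ P))
               {r} {R : Pred (Poset.Carrier P) r} (R? : Decidable R)
               (R-resp : R Respects (Poset._≈_ P)) where
  open Poset P renaming (_≤_ to _⊑_; refl to ⊑-refl)

  record MinimalAmong (cs : List Carrier) (x : Carrier) : Set (c ⊔ ℓ₁ ⊔ ℓ₂ ⊔ r) where
    field
      elem    : Carrier
      holds   : R elem
      below   : elem ⊑ x
      minimal : ∀ {z} → Any (z ≈_) cs → R z → z ⊑ elem → elem ⊑ z

  minimal-among : ∀ cs {x} → R x → MinimalAmong cs x
  minimal-among []       {x} rx = record { elem = x ; holds = rx ; below = ⊑-refl ; minimal = λ () }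
  minimal-among (c ∷ cs) {x} rx with R? c | c ≤? x
  ... | yes rc | yes c⊑x = record
    { elem = m.elem ; holds = m.holds ; below = trans m.below c⊑x
    ; minimal = λ { (here z≈c) _ _ → trans m.below (reflexive (Eq.sym z≈c))
                  ; (there z∈cs) → m.minimal z∈cs } }
    where module m = MinimalAmong (minimal-among cs rc)
  ... | yes _  | no c⋢x = record
    { elem = m.elem ; holds = m.holds ; below = m.below
    ; minimal = λ { (here z≈c) _ z⊑m →
                      ⊥-elim (c⋢x (trans (reflexive (Eq.sym z≈c)) (trans z⊑m m.below)))
                  ; (there z∈cs) → m.minimal z∈cs } }
    where module m = MinimalAmong (minimal-among cs rx)
  ... | no ¬rc | _      = record
    { elem = m.elem ; holds = m.holds ; below = m.below
    ; minimal = λ { (here z≈c) rz _ → ⊥-elim (¬rc (R-resp z≈c rz))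
                  ; (there z∈cs) → m.minimal z∈cs } }
    where module m = MinimalAmong (minimal-among cs rx)

module Least {c ℓ₁ ℓ₂} (M : MeetSemilattice c ℓ₁ ℓ₂) {xs : List (MeetSemilattice.Carrier M)}
             (cover : Covers (MeetSemilattice._≈_ M) xs)
             (_≤?_ : Decidable₂ (MeetSemilattice._≤_ M)) where
  open MeetSemilattice M renaming (_≤_ to _⊑_)

  record LeastBelow {q} (Q : Pred Carrier q) (x : Carrier) : Set (c ⊔ ℓ₂ ⊔ q) where
    field
      elem  : Carrier
      holds : Q elem
      below : elem ⊑ x
      least : ∀ {w} → Q w → elem ⊑ w

  -- A minimal element m of Q is least: for w ∈ Q, m ∧ w ∈ Q lies below m, so m ⊑ m ∧ w ⊑ w.
  least-below : ∀ {q} {Q : Pred Carrier q} → Decidable Q → Q Respects _≈_ →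
                (∀ {x y} → Q x → Q y → Q (x ∧ y)) → ∀ {x} → Q x → LeastBelow Q x
  least-below Q? Q-resp Q-∧ qx = record
    { elem = m.elem ; holds = m.holds ; below = m.below
    ; least = λ {w} qw →
        trans (m.minimal (cover (m.elem ∧ w)) (Q-∧ m.holds qw) (x∧y≤x _ _)) (x∧y≤y _ _) }
    where open Minimal poset _≤?_ Q? Q-resp
          module m = MinimalAmong (minimal-among xs qx)

-- In a finite meet-semilattice, x ⊑ y as soon as every join-irreducible below x
-- is below y.  Otherwise a minimal z with z ⊑ x, z ⋢ y is join-irreducible.
⊑-by-irreducibles : ∀ {c ℓ₁ ℓ₂} (L : MeetSemilattice c ℓ₁ ℓ₂) →
                    let open MeetSemilattice L renaming (_≤_ to _⊑_; refl to ⊑-refl) in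
                    ∀ {xs} → Covers _≈_ xs → Decidable₂ _⊑_ →
                    ∀ {x y} → (∀ l → JoinIrreducible L l → l ⊑ x → l ⊑ y) → x ⊑ y
⊑-by-irreducibles L {xs} cover _≤?_ {x} {y} below-y with x ≤? y
... | yes x⊑y = x⊑y
... | no  x⋢y = ⊥-elim (m⋢y (below-y m m-irreducible m⊑x))
  where
  open MeetSemilattice L renaming (_≤_ to _⊑_; refl to ⊑-refl)
  Escapes : Carrier → Set _
  Escapes z = z ⊑ x × ¬ z ⊑ y

  escapes-resp : Escapes Respects _≈_
  escapes-resp e (z⊑x , z⋢y) =
    trans (reflexive (Eq.sym e)) z⊑x , λ z'⊑y → z⋢y (trans (reflexive e) z'⊑y)

  open Minimal poset _≤?_ (λ z → (z ≤? x) ×-dec ¬? (z ≤? y)) escapes-resp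
  open MinimalAmong (minimal-among xs (⊑-refl , x⋢y))
    renaming (elem to m; holds to m-escapes; minimal to m-minimal)
  m⊑x : m ⊑ x
  m⊑x = proj₁ m-escapes

  m⋢y : ¬ m ⊑ y
  m⋢y = proj₂ m-escapes

  below-y-or-equal : ∀ a → a ⊑ m → a ⊑ y ⊎ m ≈ a
  below-y-or-equal a a⊑m with a ≤? y
  ... | yes a⊑y = inj₁ a⊑y
  ... | no  a⋢y = inj₂ (antisym (m-minimal (cover a) (trans a⊑m m⊑x , a⋢y) a⊑m) a⊑m)

  m-irreducible : JoinIrreducible L m
  m-irreducible = (λ m-bottom → m⋢y (m-bottom y)) , split
    where
    split : ∀ a b → IsJoinL L a b m → m ≈ a ⊎ m ≈ b
    split a b (a⊑m , b⊑m , lub) with below-y-or-equal a a⊑m | below-y-or-equal b b⊑m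
    ... | inj₂ m≈a | _        = inj₁ m≈a
    ... | inj₁ _   | inj₂ m≈b = inj₂ m≈b
    ... | inj₁ a⊑y | inj₁ b⊑y = ⊥-elim (m⋢y (lub y a⊑y b⊑y))

module Counting {c ℓ₁ ℓ₂ p} (L : MeetSemilattice c ℓ₁ ℓ₂)
                {xs : List (MeetSemilattice.Carrier L)} (cover : Covers (MeetSemilattice._≈_ L) xs)
                (_≤?_ : Decidable₂ (MeetSemilattice._≤_ L))
                (n : ℕ) (B : Pred (Power.Vecⁿ L n) p) (B? : Decidable B)
                (B-resp : Power.RespectsEq L n B)
                (B-∧ : ∀ b₁ b₂ → B b₁ → B b₂ → B (Power._∧ⁿ_ L n b₁ b₂))
                (irs : List (MeetSemilattice.Carrier L))
                (enum : Enumerates (MeetSemilattice._≈_ L) (JoinIrreducible L) irs) where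
  open MeetSemilattice L renaming (_≤_ to _⊑_; refl to ⊑-refl)
  open Power L n
  module Lⁿ = MeetSemilattice (power L n)
  open Least (power L n) (vectors-cover cover n) (λ x y → all? λ i → x i ≤? y i)

  GeneratedAt : Vecⁿ → Fin n → Carrier → Set _
  GeneratedAt b i l = B b × l ⊑ b i × (∀ w → B w → l ⊑ w i → b ≤ⁿ w)

  generated-unique : ∀ {b b' i l} → GeneratedAt b i l → GeneratedAt b' i l → b ≈ⁿ b'
  generated-unique (Bb , lb , b-least) (Bb' , lb' , b'-least) =
    Lⁿ.antisym (b-least _ Bb' lb') (b'-least _ Bb lb)

  UpperBoundIn : List Vecⁿ → Pred Vecⁿ _
  UpperBoundIn gs w = B w × All (_≤ⁿ w) gs

  join-below : ∀ gs {x} → UpperBoundIn gs x → LeastBelow (UpperBoundIn gs) x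
  join-below gs = least-below
    (λ w → B? w ×-dec All.all? (λ g → all? λ i → g i ≤? w i) gs)
    (λ e (Bw , gs≤w) → B-resp e Bw , All.map (λ g≤w → Lⁿ.trans g≤w (Lⁿ.reflexive e)) gs≤w)
    (λ (Bx , gs≤x) (By , gs≤y) →
       B-∧ _ _ Bx By , All.zipWith (λ (g≤x , g≤y) → Lⁿ.∧-greatest g≤x g≤y) (gs≤x , gs≤y))

  -- Induction:
  -- b is the join in B of the head and of the join of the tail.
  irreducible-covered : ∀ {b} → JoinIrreducibleIn B b → ∀ gs → All (λ g → B g × g ≤ⁿ b) gs →
                        (∀ {w} → UpperBoundIn gs w → b ≤ⁿ w) → Any (b ≤ⁿ_) gs
  irreducible-covered (_ , not-bottom , _) [] _ b-least =
    ⊥-elim (not-bottom λ w Bw → b-least (Bw , []))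
  irreducible-covered {b} b-irr@(Bb , _ , split) (g ∷ gs) ((Bg , g≤b) ∷ gs-below) b-least =
    [ (λ b≈g → here (Lⁿ.reflexive b≈g))
    , (λ b≈j → there (irreducible-covered b-irr gs gs-below
                        λ up → Lⁿ.trans (Lⁿ.reflexive b≈j) (j.least up)))
    ]′ (split g j.elem Bg (proj₁ j.holds) b-join)
    where
    module j = LeastBelow (join-below gs (Bb , All.map proj₂ gs-below))
    b-join : IsJoinIn B g j.elem b
    b-join = Bb , g≤b , j.below , λ w Bw g≤w j≤w →
      b-least (Bw , g≤w ∷ All.map (λ g'≤j → Lⁿ.trans g'≤j j≤w) (proj₂ j.holds))

  module Generator {b} (b-irr : JoinIrreducibleIn B b) where
    Bb : B b
    Bb = proj₁ b-irr

    Pair : Set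
    Pair = Fin n × Fin (length irs)

    Reaches : Pair → Pred Vecⁿ _
    Reaches (i , k) w = B w × (lookup irs k ⊑ b i → lookup irs k ⊑ w i)

    generatorᴸ : ∀ ik → LeastBelow (Reaches ik) b
    generatorᴸ (i , k) = least-below
      (λ w → B? w ×-dec (lookup irs k ≤? b i →-dec lookup irs k ≤? w i))
      (λ e (Bw , reach) → B-resp e Bw , λ l⊑bi → trans (reach l⊑bi) (reflexive (e i)))
      (λ (Bx , reach-x) (By , reach-y) →
         B-∧ _ _ Bx By , λ l⊑bi → ∧-greatest (reach-x l⊑bi) (reach-y l⊑bi))
      (Bb , λ l⊑bi → l⊑bi)

    generator : Pair → Vecⁿ
    generator ik = LeastBelow.elem (generatorᴸ ik)

    generators : List Vecⁿ
    generators = map generator (cartesianProduct (allFin n) (allFin (length irs)))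

    -- b lies below every upper bound of its generators in B: coordinatewise,
    -- each join-irreducible l ⊑ b i is some entry of irs, reached by its generator.
    below-upper-bounds : ∀ {w} → UpperBoundIn generators w → b ≤ⁿ w
    below-upper-bounds (_ , generators≤w) i =
      ⊑-by-irreducibles L cover _≤?_ λ l l-irr l⊑bi →
        let l∈irs  = proj₂ (proj₂ enum) l l-irr
            k      = index l∈irs
            l≈lk   = Anyₚ.lookup-index l∈irs
            reach  = proj₂ (LeastBelow.holds (generatorᴸ (i , k)))
            g≤w    = All.lookup (Allₚ.map⁻ generators≤w)
                       (∈-cartesianProduct⁺ (∈-allFin i) (∈-allFin k))
        in trans (reflexive l≈lk)
             (trans (reach (trans (reflexive (Eq.sym l≈lk)) l⊑bi)) (g≤w i))

    generators-below : All (λ g → B g × g ≤ⁿ b) generators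
    generators-below = Allₚ.map⁺ (universal (λ ik →
      proj₁ (LeastBelow.holds (generatorᴸ ik)) , LeastBelow.below (generatorᴸ ik)) _)

    -- If b lies below the generator gᵢₖ, it is generated at (i , lookup irs k):
    -- were lookup irs k ⋢ b i, then gᵢₖ and hence b would be the least element of B.
    generated-at : ∀ ik → b ≤ⁿ generator ik → GeneratedAt b (proj₁ ik) (lookup irs (proj₂ ik))
    generated-at (i , k) b≤g = Bb , l⊑bi , λ w Bw l⊑wi → Lⁿ.trans b≤g (g.least (Bw , λ _ → l⊑wi))
      where
      module g = LeastBelow (generatorᴸ (i , k))
      l⊑bi : lookup irs k ⊑ b i
      l⊑bi = decidable-stable (lookup irs k ≤? b i) λ l⋢bi →
        proj₁ (proj₂ b-irr) λ w Bw → Lⁿ.trans b≤g (g.least (Bw , λ l⊑bi → ⊥-elim (l⋢bi l⊑bi)))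

    -- b is the join in B of its generators, so it lies below one of them.
    generated : Σ[ (i , k) ∈ Pair ] GeneratedAt b i (lookup irs k)
    generated =
      let (ik , b≤g) = satisfied (Anyₚ.map⁻ (irreducible-covered b-irr generators
                                               generators-below below-upper-bounds))
      in ik , generated-at ik b≤g

  code : ∀ {b} → JoinIrreducibleIn B b → Fin (n * length irs)
  code b-irr = let ((i , k) , _) = Generator.generated b-irr in combine i k

  code-injective : ∀ {b b'} (b-irr : JoinIrreducibleIn B b) (b'-irr : JoinIrreducibleIn B b') →
                   code b-irr ≡ code b'-irr → b ≈ⁿ b'
  code-injective b-irr b'-irr =
    same-code (proj₂ (Generator.generated b-irr)) (proj₂ (Generator.generated b'-irr))
    where
    same-code : ∀ {b b' i i' k k'} → GeneratedAt b i (lookup irs k) →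
                GeneratedAt b' i' (lookup irs k') → combine i k ≡ combine i' k' → b ≈ⁿ b'
    same-code {i = i} {i'} {k} {k'} gen gen' e with combine-injective i k i' k' e
    ... | refl , refl = generated-unique gen gen'

  bound : ∀ {bs} → Distinct _≈ⁿ_ bs → All (JoinIrreducibleIn B) bs → length bs ≤ n * length irs
  bound = distinct-length-≤ Lⁿ.Eq.sym code code-injective

theorem3p1 : ∀ {c ℓ₁ ℓ₂ p} (L : MeetSemilattice c ℓ₁ ℓ₂) → FiniteSL L →
    (n : ℕ) (B : Pred (Power.Vecⁿ L n) p) →
    Power.RespectsEq L n B → Power.MeetJoinClosed L n B →
    (irs : List (MeetSemilattice.Carrier L)) →
    Enumerates (MeetSemilattice._≈_ L) (JoinIrreducible L) irs →
    (bs : List (Power.Vecⁿ L n)) →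
    Distinct (Power._≈ⁿ_ L n) bs → All (Power.JoinIrreducibleIn L n B) bs →
    length bs ≤ n * length irs
theorem3p1 L (xs , cover) n B B-resp (B-∧ , _) irs enum bs distinct irreducible =
  decidable-stable (length bs ℕ.≤? n * length irs) λ ¬bound →
    ¬¬-decidable-order (MeetSemilattice.poset L) cover λ _≤?_ →
    ¬¬-decidable (vectors-cover cover n) Lⁿ.Eq.sym B-resp λ B? →
    ¬bound (Counting.bound L cover _≤?_ n B B? B-resp B-∧ irs enum distinct irreducible)
  where module Lⁿ = MeetSemilattice (power L n)
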